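{- Let $O=(0,0)$, let $n\ge 0$, and let $A_0A_1\ldots A_{n+1}$ be a broken line in $\mathbb{R}^2$ such that $O,A_k,A_{k+1}$ are not collinear for every $k=0,\ldots,n$, with $A_0=(1,0)$ and the vector $A_0A_1$ collinear to $(0,1)$. Let $(a_0,a_1,\ldots,a_{2n})$ be its LLS-sequence. Then $$A_{n+1}=\big(Q_{2n}(a_0,a_1,\ldots,a_{2n}),\,P_{2n}(a_0,a_1,\ldots,a_{2n})\big).$$
   Context: For points $X,Y$, $XY$ denotes the vector $Y-X$; for vectors $v,w$, $|v\times w|=v_1w_2-v_2w_1$ (oriented parallelogram area). The LLS-sequence of a broken line $A_0\ldots A_{n+1}$ (with $O,A_k,A_{k+1}$ non-collinear for all $k$) is $(a_0,\ldots,a_{2n})$ where $a_{2k}=|OA_k\times OA_{k+1}|$ for $k=0,\ldots,n$ and $a_{2k-1}=\frac{|A_kA_{k-1}\times A_kA_{k+1}|}{a_{2k-2}\,a_{2k}}$ for $k=1,\ldots,n$ (so in particular $A_1=(1,a_0)$). The polynomials $P_k,Q_k$ (continuants) are defined by $P_{ -1}=1$, $P_0=a_0$, $P_k=a_kP_{k-1}+P_{k-2}$ and $Q_{ -1}=0$, $Q_0=1$, $Q_k=a_kQ_{k-1}+Q_{k-2}$; they are the polynomials with nonnegative integer coefficients satisfying $P_k/Q_k=[a_0,\ldots,a_k]=a_0+\cfrac{1}{a_1+\cfrac{1}{\ddots+\cfrac{1}{a_k}}}$ as rational functions. -}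

module Defs where

open import Level using (Level; suc; _⊔_)
open import Algebra.Bundles using (CommutativeRing)
open import Data.Nat using (ℕ; zero) renaming (suc to 1+)
open import Data.Product using (_×_; _,_; proj₁; proj₂)
open import Relation.Nullary using (¬_)

-- A field: a nontrivial commutative ring with a (total) inverse operation
-- that is a genuine inverse on nonzero elements.  ℝ is an instance.
record Field (c ℓ : Level) : Set (suc (c ⊔ ℓ)) where
  field
    commutativeRing : CommutativeRing c ℓ
  open CommutativeRing commutativeRing public
  field
    _⁻¹     : Carrier → Carrier
    ⁻¹-cong : ∀ {x y} → x ≈ y → x ⁻¹ ≈ y ⁻¹
    inverse : ∀ x → ¬ (x ≈ 0#) → x * (x ⁻¹) ≈ 1#
    0≉1     : ¬ (0# ≈ 1#)

module _ {c ℓ : Level} (F : Field c ℓ) where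
  open Field F

  Point : Set c
  Point = Carrier × Carrier

  vec : Point → Point → Point
  vec (x₁ , x₂) (y₁ , y₂) = (y₁ - x₁ , y₂ - x₂)

  -- |v × w| = v₁w₂ - v₂w₁
  cross : Point → Point → Carrier
  cross (v₁ , v₂) (w₁ , w₂) = v₁ * w₂ - v₂ * w₁

  O : Point
  O = (0# , 0#)

  CollinearVec : Point → Point → Set ℓ
  CollinearVec v w = cross v w ≈ 0#

  Collinear : Point → Point → Point → Set ℓ
  Collinear X Y Z = cross (vec X Y) (vec X Z) ≈ 0#

  _≈ᴾ_ : Point → Point → Set ℓ
  (x₁ , x₂) ≈ᴾ (y₁ , y₂) = (x₁ ≈ y₁) × (x₂ ≈ y₂)

  -- LLS-sequence of a broken line A₀ A₁ …  (points given as A : ℕ → Point):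
  --   a_{2k}   = |OA_k × OA_{k+1}|
  --   a_{2j+1} = |A_{j+1}A_j × A_{j+1}A_{j+2}| / (a_{2j} a_{2j+2})
  llsEven : (ℕ → Point) → ℕ → Carrier
  llsEven A k = cross (vec O (A k)) (vec O (A (1+ k)))

  llsOdd : (ℕ → Point) → ℕ → Carrier
  llsOdd A j = cross (vec (A (1+ j)) (A j)) (vec (A (1+ j)) (A (1+ (1+ j))))
               * ((llsEven A j * llsEven A (1+ j)) ⁻¹)

  -- llsFrom A k m = a_{2k+m}
  llsFrom : (ℕ → Point) → ℕ → ℕ → Carrier
  llsFrom A k zero = llsEven A k
  llsFrom A k (1+ zero) = llsOdd A k
  llsFrom A k (1+ (1+ m)) = llsFrom A (1+ k) m

  lls : (ℕ → Point) → ℕ → Carrier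
  lls A i = llsFrom A 0 i

  -- Continuants, shifted by one: Pˢ a k = P_{k-1}(a₀,…,a_{k-1}), so that
  -- Pˢ a 0 = P_{-1} = 1, Pˢ a 1 = P₀ = a₀,
  -- Pˢ a (k+2) = a_{k+1} Pˢ a (k+1) + Pˢ a k.
  Pˢ : (ℕ → Carrier) → ℕ → Carrier
  Pˢ a zero = 1#
  Pˢ a (1+ zero) = a 0
  Pˢ a (1+ (1+ k)) = a (1+ k) * Pˢ a (1+ k) + Pˢ a k

  -- Qˢ a 0 = Q_{-1} = 0, Qˢ a 1 = Q₀ = 1, same recursion.
  Qˢ : (ℕ → Carrier) → ℕ → Carrier
  Qˢ a zero = 0#
  Qˢ a (1+ zero) = 1#
  Qˢ a (1+ (1+ k)) = a (1+ k) * Qˢ a (1+ k) + Qˢ a k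

  P : (ℕ → Carrier) → ℕ → Carrier
  P a k = Pˢ a (1+ k)

  Q : (ℕ → Carrier) → ℕ → Carrier
  Q a k = Qˢ a (1+ k)

{-# OPTIONS --safe #-}
module Submission where

open import Defs
open import Level using (Level)
open import Data.Nat using (ℕ; _≤_) renaming (suc to 1+)
open import Data.Product using (_,_; proj₁; proj₂)
open import Relation.Nullary using (¬_)

import Data.Nat as ℕ
import Data.Nat.Properties as ℕₚ
open import Algebra.Bundles using (CommutativeRing)
open import Data.Integer as ℤ using (ℤ; +_; -[1+_]; _⊖_; _◃_; sign; ∣_∣)
import Data.Integer.Properties as ℤₚ
open import Data.Sign as Sign using (Sign)
open import Data.Maybe using (Maybe; map)
open import Data.Product.Relation.Binary.Pointwise.NonDependent using (×-setoid)
open import Relation.Binary.Bundles using (Setoid)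
open import Relation.Nullary.Decidable using (dec⇒maybe)
open import Relation.Binary.PropositionalEquality as ≡ using (_≡_)

-- Write K k = (Q_{k-1}, P_{k-1}) for the columns of continuants, so that
-- K (k+2) = a_{k+1} K (k+1) + K k and |K (2j) × K (2j+1)| = -1.  By induction
-- on j, A_{j+1} = K (2j+1) and A_jA_{j+1} = a_{2j} K (2j).  For the next edge
-- y = A_{j+1}A_{j+2}, expand y in the basis (K (2j), K (2j+1)): its first
-- coordinate is |OA_{j+1} × y| = a_{2j+2}, and its second one is |y × K (2j)|,
-- which is a_{2j+1}a_{2j+2} because a_{2j}|y × K (2j)| = |A_{j+1}A_j × y| is the
-- numerator of a_{2j+1}.
-- So y = a_{2j+2}(a_{2j+1} K (2j+1) + K (2j)) = a_{2j+2} K (2j+2), and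
-- A_{j+2} = A_{j+1} + y = K (2j+3).

-- The ring solvers of the library need decidable equality of coefficients, so
-- integer coefficients are interpreted in R along the canonical morphism ℤ → R.
module IntegerCoefficientSolver {c ℓ} (R : CommutativeRing c ℓ) where
  open CommutativeRing R
  open import Algebra.Properties.Ring ring
    using (-‿involutive; -0#≈0#; -1*x≈-x; -‿+-comm; -‿distribʳ-*)
  open import Algebra.Properties.Semiring.Mult semiring using (_×_; ×-homo-+; ×1-homo-*)
  open import Algebra.Solver.Ring.AlmostCommutativeRing
    using (fromCommutativeRing; _-Raw-AlmostCommutative⟶_)
  open import Relation.Binary.Reasoning.Setoid setoid

  fromℕ : ℕ → Carrier
  fromℕ n = n × 1#

  fromℤ : ℤ → Carrier
  fromℤ (+ n)      = fromℕ n
  fromℤ -[1+ n ]   = - fromℕ (1+ n)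

  fromSign : Sign → Carrier
  fromSign Sign.+ = 1#
  fromSign Sign.- = - 1#

  fromℤ-homo‿- : ∀ i → fromℤ (ℤ.- i) ≈ - fromℤ i
  fromℤ-homo‿- (+ ℕ.zero) = sym -0#≈0#
  fromℤ-homo‿- (+ 1+ n)   = refl
  fromℤ-homo‿- -[1+ n ]   = sym (-‿involutive _)

  [x+a]-[x+b]≈a-b : ∀ x a b → (x + a) - (x + b) ≈ a - b
  [x+a]-[x+b]≈a-b x a b = begin
    (x + a) + - (x + b)    ≈⟨ +-congˡ (sym (-‿+-comm x b)) ⟩
    (x + a) + (- x + - b)  ≈⟨ +-congʳ (+-comm x a) ⟩
    (a + x) + (- x + - b)  ≈⟨ +-assoc a x _ ⟩
    a + (x + (- x + - b))  ≈⟨ +-congˡ (sym (+-assoc x (- x) (- b))) ⟩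
    a + ((x + - x) + - b)  ≈⟨ +-congˡ (+-congʳ (-‿inverseʳ x)) ⟩
    a + (0# + - b)         ≈⟨ +-congˡ (+-identityˡ _) ⟩
    a - b                  ∎

  fromℤ-⊖ : ∀ m n → fromℤ (m ⊖ n) ≈ fromℕ m - fromℕ n
  fromℤ-⊖ m        ℕ.zero   = sym (trans (+-congˡ -0#≈0#) (+-identityʳ _))
  fromℤ-⊖ ℕ.zero   (1+ n)   = sym (+-identityˡ _)
  fromℤ-⊖ (1+ m)   (1+ n)   = begin
    fromℤ (1+ m ⊖ 1+ n)           ≡⟨ ≡.cong fromℤ (ℤₚ.[1+m]⊖[1+n]≡m⊖n m n) ⟩
    fromℤ (m ⊖ n)                 ≈⟨ fromℤ-⊖ m n ⟩
    fromℕ m - fromℕ n             ≈⟨ [x+a]-[x+b]≈a-b 1# (fromℕ m) (fromℕ n) ⟨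
    fromℕ (1+ m) - fromℕ (1+ n)   ∎

  fromℤ-homo-+ : ∀ i j → fromℤ (i ℤ.+ j) ≈ fromℤ i + fromℤ j
  fromℤ-homo-+ (+ m)    (+ n)    = ×-homo-+ 1# m n
  fromℤ-homo-+ (+ m)    -[1+ n ] = fromℤ-⊖ m (1+ n)
  fromℤ-homo-+ -[1+ m ] (+ n)    = trans (fromℤ-⊖ n (1+ m)) (+-comm _ _)
  fromℤ-homo-+ -[1+ m ] -[1+ n ] = begin
    - fromℕ (1+ (1+ (m ℕ.+ n)))      ≡⟨ ≡.cong (λ k → - fromℕ (1+ k)) (ℕₚ.+-suc m n) ⟨
    - fromℕ (1+ m ℕ.+ 1+ n)          ≈⟨ -‿cong (×-homo-+ 1# (1+ m) (1+ n)) ⟩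
    - (fromℕ (1+ m) + fromℕ (1+ n))  ≈⟨ -‿+-comm _ _ ⟨
    - fromℕ (1+ m) + - fromℕ (1+ n)  ∎

  fromSign-homo-* : ∀ s t → fromSign (s Sign.* t) ≈ fromSign s * fromSign t
  fromSign-homo-* Sign.+ t      = sym (*-identityˡ _)
  fromSign-homo-* Sign.- Sign.+ = sym (*-identityʳ _)
  fromSign-homo-* Sign.- Sign.- = begin
    1#             ≈⟨ -‿involutive 1# ⟨
    - - 1#         ≈⟨ -‿cong (-1*x≈-x 1#) ⟨
    - (- 1# * 1#)  ≈⟨ -‿distribʳ-* _ _ ⟩
    - 1# * - 1#    ∎

  fromℤ-◃ : ∀ s n → fromℤ (s ◃ n) ≈ fromSign s * fromℕ n
  fromℤ-◃ s      ℕ.zero = sym (zeroʳ _)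
  fromℤ-◃ Sign.+ (1+ n) = sym (*-identityˡ _)
  fromℤ-◃ Sign.- (1+ n) = sym (-1*x≈-x _)

  [ab][cd]≈[ac][bd] : ∀ a b c d → (a * b) * (c * d) ≈ (a * c) * (b * d)
  [ab][cd]≈[ac][bd] a b c d = begin
    (a * b) * (c * d)  ≈⟨ *-assoc a b _ ⟩
    a * (b * (c * d))  ≈⟨ *-congˡ (*-assoc b c d) ⟨
    a * ((b * c) * d)  ≈⟨ *-congˡ (*-congʳ (*-comm b c)) ⟩
    a * ((c * b) * d)  ≈⟨ *-congˡ (*-assoc c b d) ⟩
    a * (c * (b * d))  ≈⟨ *-assoc a c _ ⟨
    (a * c) * (b * d)  ∎

  fromℤ-homo-* : ∀ i j → fromℤ (i ℤ.* j) ≈ fromℤ i * fromℤ j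
  fromℤ-homo-* i j = begin
    fromℤ (i ℤ.* j)
      ≈⟨ fromℤ-◃ (sign i Sign.* sign j) (∣ i ∣ ℕ.* ∣ j ∣) ⟩
    fromSign (sign i Sign.* sign j) * fromℕ (∣ i ∣ ℕ.* ∣ j ∣)
      ≈⟨ *-cong (fromSign-homo-* (sign i) (sign j)) (×1-homo-* ∣ i ∣ ∣ j ∣) ⟩
    (fromSign (sign i) * fromSign (sign j)) * (fromℕ ∣ i ∣ * fromℕ ∣ j ∣)
      ≈⟨ [ab][cd]≈[ac][bd] _ _ _ _ ⟩
    (fromSign (sign i) * fromℕ ∣ i ∣) * (fromSign (sign j) * fromℕ ∣ j ∣)
      ≈⟨ *-cong (fromℤ-◃ (sign i) ∣ i ∣) (fromℤ-◃ (sign j) ∣ j ∣) ⟨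
    fromℤ (sign i ◃ ∣ i ∣) * fromℤ (sign j ◃ ∣ j ∣)
      ≡⟨ ≡.cong₂ (λ x y → fromℤ x * fromℤ y) (ℤₚ.◃-inverse i) (ℤₚ.◃-inverse j) ⟩
    fromℤ i * fromℤ j
      ∎

  fromℤ-morphism : ℤ.+-*-rawRing -Raw-AlmostCommutative⟶ fromCommutativeRing R
  fromℤ-morphism = record
    { ⟦_⟧    = fromℤ
    ; +-homo = fromℤ-homo-+
    ; *-homo = fromℤ-homo-*
    ; -‿homo = fromℤ-homo‿-
    ; 0-homo = refl
    ; 1-homo = +-identityʳ 1#
    }

  fromℤ-≟ : ∀ i j → Maybe (fromℤ i ≈ fromℤ j)
  fromℤ-≟ i j = map (λ { ≡.refl → refl }) (dec⇒maybe (i ℤ.≟ j))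

  open import Algebra.Solver.Ring ℤ.+-*-rawRing (fromCommutativeRing R) fromℤ-morphism fromℤ-≟ public

module _ {f ℓ} (F : Field f ℓ) where
  open Field F
  open import Data.Product using (_×_)
  open IntegerCoefficientSolver commutativeRing using (solve; _:+_; _:*_; _:-_; :-_; _:=_; con)
  open import Relation.Binary.Reasoning.Setoid setoid
  open import Algebra.Properties.Ring ring using (-‿involutive)

  pointSetoid : Setoid f ℓ
  pointSetoid = ×-setoid setoid setoid

  open Setoid pointSetoid using ()
    renaming (refl to ≈ᴾ-refl; sym to ≈ᴾ-sym; trans to ≈ᴾ-trans)

  infixl 6 _+ᴾ_
  infixr 7 _·ᴾ_

  _+ᴾ_ : Point F → Point F → Point F
  (x₁ , x₂) +ᴾ (y₁ , y₂) = (x₁ + y₁ , x₂ + y₂)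

  _·ᴾ_ : Carrier → Point F → Point F
  s ·ᴾ (x₁ , x₂) = (s * x₁ , s * x₂)

  +ᴾ-cong : ∀ {x x′ y y′} → _≈ᴾ_ F x x′ → _≈ᴾ_ F y y′ → _≈ᴾ_ F (x +ᴾ y) (x′ +ᴾ y′)
  +ᴾ-cong (x₁≈ , x₂≈) (y₁≈ , y₂≈) = +-cong x₁≈ y₁≈ , +-cong x₂≈ y₂≈

  ·ᴾ-cong : ∀ {s t x y} → s ≈ t → _≈ᴾ_ F x y → _≈ᴾ_ F (s ·ᴾ x) (t ·ᴾ y)
  ·ᴾ-cong s≈t (x₁≈y₁ , x₂≈y₂) = *-cong s≈t x₁≈y₁ , *-cong s≈t x₂≈y₂

  cross-cong : ∀ {u u′ v v′} → _≈ᴾ_ F u u′ → _≈ᴾ_ F v v′ → cross F u v ≈ cross F u′ v′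
  cross-cong (u₁≈ , u₂≈) (v₁≈ , v₂≈) = +-cong (*-cong u₁≈ v₂≈) (-‿cong (*-cong u₂≈ v₁≈))

  vec-+ : ∀ U X → _≈ᴾ_ F X (vec F U X +ᴾ U)
  vec-+ (U₁ , U₂) (X₁ , X₂) = split U₁ X₁ , split U₂ X₂
    where
    split : ∀ u x → x ≈ (x - u) + u
    split = solve 2 (λ u x → x := (x :- u) :+ u) refl

  *-nonzero : ∀ {x y} → ¬ x ≈ 0# → ¬ y ≈ 0# → ¬ x * y ≈ 0#
  *-nonzero {x} {y} x≉0 y≉0 xy≈0 = x≉0 (begin
    x                ≈⟨ *-identityʳ x ⟨
    x * 1#           ≈⟨ *-congˡ (inverse y y≉0) ⟨
    x * (y * y ⁻¹)   ≈⟨ *-assoc x y _ ⟨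
    (x * y) * y ⁻¹   ≈⟨ *-congʳ xy≈0 ⟩
    0# * y ⁻¹        ≈⟨ zeroˡ _ ⟩
    0#               ∎)

  cramer : ∀ u v y →
    _≈ᴾ_ F (cross F v y ·ᴾ u +ᴾ cross F y u ·ᴾ v) ((- cross F u v) ·ᴾ y)
  cramer (u₁ , u₂) (v₁ , v₂) (y₁ , y₂) =
    solve 6 (λ u₁ u₂ v₁ v₂ y₁ y₂ →
      (v₁ :* y₂ :- v₂ :* y₁) :* u₁ :+ (y₁ :* u₂ :- y₂ :* u₁) :* v₁
        := (:- (u₁ :* v₂ :- u₂ :* v₁)) :* y₁) refl u₁ u₂ v₁ v₂ y₁ y₂ ,
    solve 6 (λ u₁ u₂ v₁ v₂ y₁ y₂ →
      (v₁ :* y₂ :- v₂ :* y₁) :* u₂ :+ (y₁ :* u₂ :- y₂ :* u₁) :* v₂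
        := (:- (u₁ :* v₂ :- u₂ :* v₁)) :* y₂) refl u₁ u₂ v₁ v₂ y₁ y₂

  basis-expansion : ∀ {u v} y → cross F u v ≈ - 1# →
    _≈ᴾ_ F y (cross F v y ·ᴾ u +ᴾ cross F y u ·ᴾ v)
  basis-expansion {u} {v} y det≈-1 =
    ≈ᴾ-sym (≈ᴾ-trans (cramer u v y) (≈ᴾ-trans (·ᴾ-cong -det≈1 ≈ᴾ-refl) (*-identityˡ _ , *-identityˡ _)))
    where
    -det≈1 : - cross F u v ≈ 1#
    -det≈1 = trans (-‿cong det≈-1) (-‿involutive 1#)

  next-edge : ∀ R U X u v →
    let E = cross F (vec F (O F) R) (vec F (O F) U)
        b = cross F (vec F (O F) U) (vec F (O F) X)
        c = cross F (vec F U R) (vec F U X) * (E * b) ⁻¹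
    in ¬ E ≈ 0# → ¬ b ≈ 0# → cross F u v ≈ - 1# →
       _≈ᴾ_ F U v → _≈ᴾ_ F (vec F R U) (E ·ᴾ u) →
       _≈ᴾ_ F (vec F U X) (b ·ᴾ (c ·ᴾ v +ᴾ u))
  next-edge R@(R₁ , R₂) U@(U₁ , U₂) X@(X₁ , X₂) u v E≉0 b≉0 det≈-1 U≈v RU≈Eu =
    ≈ᴾ-trans (basis-expansion y det≈-1)
      (≈ᴾ-trans (+ᴾ-cong (·ᴾ-cong cross-v-y ≈ᴾ-refl) (·ᴾ-cong cross-y-u ≈ᴾ-refl))
        (factor (proj₁ u) (proj₁ v) , factor (proj₂ u) (proj₂ v)))
    where
    E b c : Carrier
    E = cross F (vec F (O F) R) (vec F (O F) U)
    b = cross F (vec F (O F) U) (vec F (O F) X)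
    c = cross F (vec F U R) (vec F U X) * (E * b) ⁻¹

    y : Point F
    y = vec F U X

    cross-v-y : cross F v y ≈ b
    cross-v-y = begin
      cross F v y  ≈⟨ cross-cong (≈ᴾ-sym U≈v) ≈ᴾ-refl ⟩
      cross F U y  ≈⟨ solve 4 (λ U₁ U₂ X₁ X₂ →
                        U₁ :* (X₂ :- U₂) :- U₂ :* (X₁ :- U₁)
                          := (U₁ :- con (+ 0)) :* (X₂ :- con (+ 0)) :- (U₂ :- con (+ 0)) :* (X₁ :- con (+ 0)))
                        refl U₁ U₂ X₁ X₂ ⟩
      b            ∎

    cross-y-u : cross F y u ≈ c * b
    cross-y-u = sym (begin
      c * b                                  ≈⟨ *-congʳ (*-congʳ E*cross-y-u) ⟨
      ((E * cross F y u) * (E * b) ⁻¹) * b   ≈⟨ solve 4 (λ E w i b → ((E :* w) :* i) :* b := w :* ((E :* b) :* i))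
                                                  refl E (cross F y u) ((E * b) ⁻¹) b ⟩
      cross F y u * ((E * b) * (E * b) ⁻¹)   ≈⟨ *-congˡ (inverse (E * b) (*-nonzero E≉0 b≉0)) ⟩
      cross F y u * 1#                       ≈⟨ *-identityʳ _ ⟩
      cross F y u                            ∎)
      where
      E*cross-y-u : E * cross F y u ≈ cross F (vec F U R) y
      E*cross-y-u = begin
        E * cross F y u        ≈⟨ solve 5 (λ E y₁ y₂ u₁ u₂ →
                                    E :* (y₁ :* u₂ :- y₂ :* u₁) := y₁ :* (E :* u₂) :- y₂ :* (E :* u₁))
                                  refl E (X₁ - U₁) (X₂ - U₂) (proj₁ u) (proj₂ u) ⟩
        cross F y (E ·ᴾ u)     ≈⟨ cross-cong ≈ᴾ-refl (≈ᴾ-sym RU≈Eu) ⟩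
        cross F y (vec F R U)  ≈⟨ solve 6 (λ R₁ R₂ U₁ U₂ X₁ X₂ →
                                    (X₁ :- U₁) :* (U₂ :- R₂) :- (X₂ :- U₂) :* (U₁ :- R₁)
                                      := (R₁ :- U₁) :* (X₂ :- U₂) :- (R₂ :- U₂) :* (X₁ :- U₁))
                                  refl R₁ R₂ U₁ U₂ X₁ X₂ ⟩
        cross F (vec F U R) y  ∎

    factor : ∀ u₁ v₁ → b * u₁ + (c * b) * v₁ ≈ b * (c * v₁ + u₁)
    factor = solve 4 (λ b c u₁ v₁ → b :* u₁ :+ (c :* b) :* v₁ := b :* (c :* v₁ :+ u₁)) refl b c

  convergent : (ℕ → Carrier) → ℕ → Point F
  convergent a k = (Qˢ F a k , Pˢ F a k)

  cross-convergent-suc : ∀ a k →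
    cross F (convergent a (1+ k)) (convergent a (1+ (1+ k)))
      ≈ - cross F (convergent a k) (convergent a (1+ k))
  cross-convergent-suc a k =
    solve 5 (λ x q p q′ p′ → q :* (x :* p :+ p′) :- p :* (x :* q :+ q′) := :- (q′ :* p :- p′ :* q))
      refl (a (1+ k)) (Qˢ F a (1+ k)) (Pˢ F a (1+ k)) (Qˢ F a k) (Pˢ F a k)

  cross-convergent-even : ∀ a j → cross F (convergent a (2 ℕ.* j)) (convergent a (1+ (2 ℕ.* j))) ≈ - 1#
  cross-convergent-even a ℕ.zero =
    trans (+-cong (zeroˡ (a 0)) (-‿cong (*-identityʳ 1#))) (+-identityˡ (- 1#))
  cross-convergent-even a (1+ j) =
    ≡.subst (λ k → cross F (convergent a k) (convergent a (1+ k)) ≈ - 1#) (≡.sym (ℕₚ.*-suc 2 j)) (begin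
    cross F (convergent a (1+ (1+ m))) (convergent a (1+ (1+ (1+ m))))  ≈⟨ cross-convergent-suc a (1+ m) ⟩
    - cross F (convergent a (1+ m)) (convergent a (1+ (1+ m)))         ≈⟨ -‿cong (cross-convergent-suc a m) ⟩
    - - cross F (convergent a m) (convergent a (1+ m))                 ≈⟨ -‿involutive _ ⟩
    cross F (convergent a m) (convergent a (1+ m))                     ≈⟨ cross-convergent-even a j ⟩
    - 1#                                                               ∎)
    where
    m : ℕ
    m = 2 ℕ.* j

  llsFrom-even : ∀ A k j → llsFrom F A k (2 ℕ.* j) ≡ llsEven F A (j ℕ.+ k)
  llsFrom-even A k ℕ.zero   = ≡.refl
  llsFrom-even A k (1+ j) =
    ≡.trans (≡.cong (llsFrom F A k) (ℕₚ.*-suc 2 j))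
      (≡.trans (llsFrom-even A (1+ k) j) (≡.cong (llsEven F A) (ℕₚ.+-suc j k)))

  llsFrom-odd : ∀ A k j → llsFrom F A k (1+ (2 ℕ.* j)) ≡ llsOdd F A (j ℕ.+ k)
  llsFrom-odd A k ℕ.zero   = ≡.refl
  llsFrom-odd A k (1+ j) =
    ≡.trans (≡.cong (λ i → llsFrom F A k (1+ i)) (ℕₚ.*-suc 2 j))
      (≡.trans (llsFrom-odd A (1+ k) j) (≡.cong (llsOdd F A) (ℕₚ.+-suc j k)))

  lls-even : ∀ A j → lls F A (2 ℕ.* j) ≡ llsEven F A j
  lls-even A j = ≡.trans (llsFrom-even A 0 j) (≡.cong (llsEven F A) (ℕₚ.+-identityʳ j))

  lls-odd : ∀ A j → lls F A (1+ (2 ℕ.* j)) ≡ llsOdd F A j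
  lls-odd A j = ≡.trans (llsFrom-odd A 0 j) (≡.cong (llsOdd F A) (ℕₚ.+-identityʳ j))

  EdgeInvariant : (ℕ → Point F) → ℕ → Set ℓ
  EdgeInvariant A j =
    _≈ᴾ_ F (A (1+ j)) (convergent (lls F A) (1+ (2 ℕ.* j))) ×
    _≈ᴾ_ F (vec F (A j) (A (1+ j))) (lls F A (2 ℕ.* j) ·ᴾ convergent (lls F A) (2 ℕ.* j))

  edge-invariant-zero : ∀ A → _≈ᴾ_ F (A 0) (1# , 0#) → CollinearVec F (vec F (A 0) (A 1)) (0# , 1#) →
    EdgeInvariant A 0
  edge-invariant-zero A (r₁≈1 , r₂≈0) vertical =
    (x≈1 , y≈a₀) , trans x-r₁≈0 (sym (zeroʳ _)) , trans y-r₂≈y (trans y≈a₀ (sym (*-identityʳ _)))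
    where
    r₁ r₂ x y : Carrier
    r₁ = proj₁ (A 0)
    r₂ = proj₂ (A 0)
    x = proj₁ (A 1)
    y = proj₂ (A 1)

    -- 1# is passed to the solver as a variable: the constant con (+ 1) denotes 1# + 0#.
    x-r₁≈0 : x - r₁ ≈ 0#
    x-r₁≈0 = begin
      x - r₁                                   ≈⟨ *-identityʳ _ ⟨
      (x - r₁) * 1#                            ≈⟨ solve 3 (λ w₁ w₂ one → w₁ :* one := w₁ :* one :- w₂ :* con (+ 0))
                                                    refl (x - r₁) (y - r₂) 1# ⟩
      cross F (vec F (A 0) (A 1)) (0# , 1#)    ≈⟨ vertical ⟩
      0#                                       ∎

    x≈1 : x ≈ 1#
    x≈1 = trans (proj₁ (vec-+ (A 0) (A 1))) (trans (+-cong x-r₁≈0 r₁≈1) (+-identityˡ 1#))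

    y≈a₀ : y ≈ lls F A 0
    y≈a₀ = begin
      y
        ≈⟨ *-identityˡ y ⟨
      1# * y
        ≈⟨ solve 3 (λ one x y → one :* y := (one :- con (+ 0)) :* (y :- con (+ 0))
                                             :- (con (+ 0) :- con (+ 0)) :* (x :- con (+ 0)))
             refl 1# x y ⟩
      cross F (vec F (O F) (1# , 0#)) (vec F (O F) (A 1))
        ≈⟨ cross-cong (+-congʳ (sym r₁≈1) , +-congʳ (sym r₂≈0)) ≈ᴾ-refl ⟩
      lls F A 0
        ∎

    y-r₂≈y : y - r₂ ≈ y
    y-r₂≈y = trans (+-congˡ (-‿cong r₂≈0)) (solve 1 (λ y → y :- con (+ 0) := y) refl y)

  edge-invariant-suc : ∀ A j → ¬ llsEven F A j ≈ 0# → ¬ llsEven F A (1+ j) ≈ 0# →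
    EdgeInvariant A j → EdgeInvariant A (1+ j)
  edge-invariant-suc A j E≉0 b≉0 (U≈v , RU≈Eu) =
    ≡.subst (λ k → _≈ᴾ_ F (A (1+ (1+ j))) (K (1+ k)) ×
                   _≈ᴾ_ F (vec F (A (1+ j)) (A (1+ (1+ j)))) (a k ·ᴾ K k))
      (≡.sym (ℕₚ.*-suc 2 j)) (vertex , edge)
    where
    a : ℕ → Carrier
    a = lls F A
    K : ℕ → Point F
    K = convergent a
    m : ℕ
    m = 2 ℕ.* j

    a[2+m]≡b : a (1+ (1+ m)) ≡ llsEven F A (1+ j)
    a[2+m]≡b = ≡.trans (≡.cong a (≡.sym (ℕₚ.*-suc 2 j))) (lls-even A (1+ j))

    edge : _≈ᴾ_ F (vec F (A (1+ j)) (A (1+ (1+ j)))) (a (1+ (1+ m)) ·ᴾ K (1+ (1+ m)))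
    edge = ≈ᴾ-trans
      (next-edge (A j) (A (1+ j)) (A (1+ (1+ j))) (K m) (K (1+ m)) E≉0 b≉0 (cross-convergent-even a j)
        U≈v (≈ᴾ-trans RU≈Eu (·ᴾ-cong (reflexive (lls-even A j)) ≈ᴾ-refl)))
      (·ᴾ-cong (reflexive (≡.sym a[2+m]≡b))
        (+ᴾ-cong (·ᴾ-cong (reflexive (≡.sym (lls-odd A j))) ≈ᴾ-refl) ≈ᴾ-refl))

    vertex : _≈ᴾ_ F (A (1+ (1+ j))) (K (1+ (1+ (1+ m))))
    vertex = ≈ᴾ-trans (vec-+ (A (1+ j)) (A (1+ (1+ j)))) (+ᴾ-cong edge U≈v)

  edge-invariant : ∀ A n → (∀ k → k ≤ n → ¬ llsEven F A k ≈ 0#) →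
    _≈ᴾ_ F (A 0) (1# , 0#) → CollinearVec F (vec F (A 0) (A 1)) (0# , 1#) →
    ∀ j → j ≤ n → EdgeInvariant A j
  edge-invariant A n nondegenerate A₀≈ vertical ℕ.zero    _      = edge-invariant-zero A A₀≈ vertical
  edge-invariant A n nondegenerate A₀≈ vertical (1+ j) j<n =
    edge-invariant-suc A j (nondegenerate j j≤n) (nondegenerate (1+ j) j<n)
      (edge-invariant A n nondegenerate A₀≈ vertical j j≤n)
    where
    j≤n : j ≤ n
    j≤n = ℕₚ.<⇒≤ j<n

open import Data.Nat using (_*_)

mainTheorem3 : ∀ {c ℓ : Level} (F : Field c ℓ) →
    (n : ℕ) (A : ℕ → Point F) →
    (∀ k → k ≤ n → ¬ Collinear F (O F) (A k) (A (1+ k))) →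
    _≈ᴾ_ F (A 0) (Field.1# F , Field.0# F) →
    CollinearVec F (vec F (A 0) (A 1)) (Field.0# F , Field.1# F) →
    _≈ᴾ_ F (A (1+ n)) (Q F (lls F A) (2 * n) , P F (lls F A) (2 * n))
mainTheorem3 F n A nondegenerate A₀≈ vertical =
  proj₁ (edge-invariant F A n nondegenerate A₀≈ vertical n ℕₚ.≤-refl)
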